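{- Let $Y$ be a topological space and $L=\mathcal{O}(Y)$ its Heyting algebra of open sets. Let $\mathfrak{X}=(X,(R_j)_{j\in J})$ be a relational structure of type $\tau$. Then there is an isomorphism $\Phi:L^{\mathfrak{X}}\to\hat{\mathfrak{X}}^+$ from the convolution algebra of $\mathfrak{X}$ over $L$ to the complex algebra of the constant relational étalé $\hat{\mathfrak{X}}$, where $\Phi(\alpha)$ is the subobject $A$ of $\hat{X}$ with cross sections $A\cap(\{x\}\times Y)=\{x\}\times\alpha(x)$ for each $x\in X$.
   Context: A type is a function $\tau:J\to\mathbb{N}$, writing $n_j=\tau(j)$. A relational structure $\mathfrak{X}=(X,(R_j)_J)$ of type $\tau$ is a set $X$ with an $(n_j+1)$-ary relation $R_j\subseteq X^{n_j+1}$ for each $j\in J$. For a complete lattice $L$, the convolution algebra $L^{\mathfrak{X}}=(L^X,(f_j)_J)$ has underlying set all functions $\alpha:X\to L$ and $n_j$-ary operations $f_j(\alpha_1,\dots,\alpha_{n_j})(x)=\bigvee\{\alpha_1(x_1)\wedge\cdots\wedge\alpha_{n_j}(x_{n_j})\mid (x_1,\dots,x_{n_j},x)\in R_j\}$. An étalé space over $Y$ is a topological space $E$ with a local homeomorphism $\pi:E\to Y$; morphisms are continuous maps commuting with projections to $Y$; subobjects of $(E,\pi)$ (equivalence classes of monomorphisms into it) correspond to open subsets of $E$, and $\mathrm{Sub}(E,\pi)$ denotes the poset of subobjects. The product of étalé spaces $(E_i,\pi_i)$ is the subspace of $\prod E_i$ of tuples with equal images under the $\pi_i$, projecting to that common value.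 For a set $X$, the constant étalé $\hat{X}$ is $X\times Y$ ($X$ discrete) with projection to $Y$; $\hat{X}^n$ is the constant étalé for $X^n$, so for $R\subseteq X^{n}$ the constant étalé $\hat R$ is a subobject of $\hat X^{n}$. The constant relational étalé of $\mathfrak{X}$ is $\hat{\mathfrak{X}}=(\hat X,(\hat R_j)_J)$. For a subobject $R$ of $(E,\pi)^{n+1}$ and subobjects $A_1,\dots,A_n$ of $(E,\pi)$, the étalé relational image is $R(A_1,\dots,A_n)=\pi_{n+1}((A_1\times\cdots\times A_n\times E)\cap R)$ (projection to the last coordinate). For a relational étalé $\mathcal{E}=(E,\pi,(R_j)_J)$ (an étalé space with a subobject $R_j$ of $(E,\pi)^{n_j+1}$ for each $j$), its complex algebra is $\mathcal{E}^+=(\mathrm{Sub}(E,\pi),(g_j)_J)$ with $g_j(A_1,\dots,A_{n_j})=R_j(A_1,\dots,A_{n_j})$. The isomorphism is one of algebras of type $\tau$ that is also a Heyting algebra isomorphism between $L^X$ (pointwise order) and $\mathrm{Sub}(\hat X)$. -}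

module Defs where

open import Data.Nat using (ℕ; zero; suc)
open import Data.Fin using (Fin; zero; suc)
open import Data.Product using (Σ; _×_; _,_; proj₁; proj₂)
open import Data.Unit using (⊤; tt)
open import Function using (_∘_)

-- A topological space on a carrier Y: a family of open subsets (predicates
-- on Y), closed under arbitrary unions (indexed by any I : Set), binary
-- intersections, containing the whole space, and invariant under extensional
-- equality of predicates (there is no function/propositional extensionality).
record Topology (Y : Set) : Set₁ where
  field
    IsOpen    : (Y → Set) → Set
    IsOpen-resp : ∀ {U V : Y → Set} →
                  (∀ y → U y → V y) → (∀ y → V y → U y) → IsOpen U → IsOpen V
    IsOpen-univ : IsOpen (λ _ → ⊤)
    IsOpen-∩  : ∀ {U V : Y → Set} → IsOpen U → IsOpen V → IsOpen (λ y → U y × V y)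
    IsOpen-⋃  : (I : Set) (U : I → Y → Set) → (∀ i → IsOpen (U i)) →
                IsOpen (λ y → Σ I (λ i → U i y))

open Topology public

module _ {Y : Set} (T : Topology Y) where

  OpenSet : Set₁
  OpenSet = Σ (Y → Set) (IsOpen T)

  IsOpen-⋀ : (n : ℕ) (U : Fin n → Y → Set) → (∀ i → IsOpen T (U i)) →
             IsOpen T (λ y → ∀ i → U i y)
  IsOpen-⋀ zero U _ =
    IsOpen-resp T (λ _ _ ()) (λ _ _ → tt) (IsOpen-univ T)
  IsOpen-⋀ (suc n) U o =
    IsOpen-resp T (λ y p → λ { zero → proj₁ p ; (suc i) → proj₂ p i })
                  (λ y q → q zero , (λ i → q (suc i)))
                  (IsOpen-∩ T (o zero) (IsOpen-⋀ n (U ∘ suc) (o ∘ suc)))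

  module _ {X : Set} where

    _≤L_ : (X → OpenSet) → (X → OpenSet) → Set
    α ≤L β = ∀ x y → proj₁ (α x) y → proj₁ (β x) y

    -- convolution operation f_j for an (n+1)-ary relation R ⊆ X^n × X:
    -- f(α₁..αₙ)(x) = ⋁ { α₁(x₁) ∧ … ∧ αₙ(xₙ) | (x₁,…,xₙ,x) ∈ R }
    conv : (n : ℕ) (R : (Fin n → X) → X → Set) →
           (Fin n → (X → OpenSet)) → (X → OpenSet)
    conv n R αs x =
      (λ y → Σ (Fin n → X) (λ xs → R xs x × (∀ i → proj₁ (αs i (xs i)) y))) ,
      IsOpen-resp T
        (λ y p → proj₁ (proj₁ p) , proj₂ (proj₁ p) , proj₂ p)
        (λ y q → (proj₁ q , proj₁ (proj₂ q)) , proj₂ (proj₂ q))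
        (IsOpen-⋃ T (Σ (Fin n → X) (λ xs → R xs x))
                    (λ p y → ∀ i → proj₁ (αs i (proj₁ p i)) y)
                    (λ p → IsOpen-⋀ n (λ i y → proj₁ (αs i (proj₁ p i)) y)
                                      (λ i → proj₂ (αs i (proj₁ p i)))))

    -- The constant étalé X̂ = X × Y (X discrete, product topology) over Y.
    -- Open subsets of X × Y in the product topology: every point has a basic
    -- open neighbourhood S × V (S ⊆ X arbitrary since X is discrete, V open in Y).
    IsProdOpen : (X × Y → Set) → Set₁
    IsProdOpen U = ∀ x y → U (x , y) →
      Σ (X → Set) λ S → Σ (Y → Set) λ V →
        IsOpen T V × S x × V y × (∀ x' y' → S x' → V y' → U (x' , y'))

    -- Sub(X̂): subobjects of the constant étalé = open subsets of X × Y
    Sub : Set₁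
    Sub = Σ (X × Y → Set) IsProdOpen

    _⊆S_ : Sub → Sub → Set
    A ⊆S B = ∀ p → proj₁ A p → proj₁ B p

    _≈S_ : Sub → Sub → Set
    A ≈S B = (A ⊆S B) × (B ⊆S A)

    -- Étalé relational image for the constant relational étalé R̂ = R × Y.
    -- A point of (X̂)^{n+1} (fibred product over Y) is ((x₁,y),…,(xₙ,y),(x,y));
    -- R̂(A₁..Aₙ) = π_{n+1}((A₁ × … × Aₙ × X̂) ∩ R̂), as a subset of X × Y.
    image : (n : ℕ) (R : (Fin n → X) → X → Set) → (Fin n → Sub) → (X × Y → Set)
    image n R As (x , y) =
      Σ (Fin n → X) λ xs → R xs x × (∀ i → proj₁ (As i) (xs i , y))

{-# OPTIONS --safe #-}
-- An open subset of X × Y with X discrete is the same thing as the family of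
-- its sections {y | (x , y) ∈ A}, each open in Y; conversely a family α of opens
-- assembles into the open set ⋃ₓ {x} × α(x).  Under this correspondence the
-- inclusion of subobjects is the pointwise order, and the étalé relational
-- image of R̂ is computed section by section, which is the convolution
-- formula.
module Submission where

open import Defs
open import Data.Nat using (ℕ)
open import Data.Fin using (Fin)
open import Data.Product using (Σ; _×_; _,_; proj₁; proj₂)
open import Function using (_∘_; _⇔_; id; mk⇔)
open import Function.Construct.Identity using (⇔-id)
open import Relation.Binary.PropositionalEquality using (_≡_; refl)

module _ {Y : Set} (T : Topology Y) {X : Set} where

  IsOpen-section : {U : X × Y → Set} → IsProdOpen T U → ∀ x → IsOpen T (λ y → U (x , y))
  IsOpen-section {U} U-open x =
    IsOpen-resp T nbhds-cover covered-by-nbhds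
      (IsOpen-⋃ T (Σ Y λ y → U (x , y)) nbhd nbhd-open)
    where
    nbhd : Σ Y (λ y → U (x , y)) → Y → Set
    nbhd (y , u) = let (_ , V , _) = U-open x y u in V

    nbhd-open : ∀ i → IsOpen T (nbhd i)
    nbhd-open (y , u) = let (_ , _ , V-open , _) = U-open x y u in V-open

    covered-by-nbhds : ∀ y → U (x , y) → Σ _ λ i → nbhd i y
    covered-by-nbhds y u = let (_ , _ , _ , _ , y∈V , _) = U-open x y u in (y , u) , y∈V

    nbhds-cover : ∀ y' → Σ _ (λ i → nbhd i y') → U (x , y')
    nbhds-cover y' ((y , u) , y'∈V) =
      let (_ , _ , _ , x∈S , _ , S×V⊆U) = U-open x y u in S×V⊆U x y' x∈S y'∈V

  section : Sub T → X → OpenSet T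
  section (A , A-open) x = (λ y → A (x , y)) , IsOpen-section A-open x

  -- Φ(α); the basic neighbourhood of (x , y) is {x} × α(x).
  fromSections : (X → OpenSet T) → Sub T
  fromSections α =
    (λ (x , y) → proj₁ (α x) y) ,
    λ x y y∈αx → (_≡ x) , proj₁ (α x) , proj₂ (α x) , refl , y∈αx ,
                 λ { _ _ refl y'∈αx → y'∈αx }

  fromSections-section : (A : Sub T) → _≈S_ T (fromSections (section A)) A
  fromSections-section A = (λ _ → id) , (λ _ → id)

  ≤L⇔⊆S : (α β : X → OpenSet T) → _≤L_ T α β ⇔ _⊆S_ T (fromSections α) (fromSections β)
  ≤L⇔⊆S α β = mk⇔ (λ α≤β (x , y) → α≤β x y) (λ α⊆β x y → α⊆β (x , y))

  fromSections-conv : (n : ℕ) (R : (Fin n → X) → X → Set) (αs : Fin n → X → OpenSet T) →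
    ∀ p → proj₁ (fromSections (conv T n R αs)) p ⇔ image T n R (fromSections ∘ αs) p
  fromSections-conv n R αs p = ⇔-id _

theorem3 : (Y : Set) (T : Topology Y) (X : Set) (J : Set) (τ : J → ℕ)
           (R : (j : J) → (Fin (τ j) → X) → X → Set) →
           Σ ((X → OpenSet T) → Sub T {X}) λ Φ →
             -- cross sections: Φ(α) ∩ ({x} × Y) = {x} × α(x)
             (∀ α x y → proj₁ (Φ α) (x , y) ⇔ proj₁ (α x) y)
             -- order embedding (pointwise order on L^X vs inclusion of subobjects)
             × (∀ α β → (_≤L_ T α β) ⇔ (_⊆S_ T (Φ α) (Φ β)))
             -- surjective onto Sub(X̂) (up to equality of subobjects)
             × (∀ A → Σ (X → OpenSet T) λ α → _≈S_ T (Φ α) A)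
             -- homomorphism of algebras of type τ: Φ(f_j(α⃗)) = R̂_j(Φ α⃗)
             × (∀ j (αs : Fin (τ j) → (X → OpenSet T)) →
                  (∀ p → proj₁ (Φ (conv T (τ j) (R j) αs)) p
                         ⇔ image T (τ j) (R j) (Φ ∘ αs) p))
theorem3 Y T X J τ R =
  fromSections T ,
  (λ α x y → ⇔-id _) ,
  ≤L⇔⊆S T ,
  (λ A → section T A , fromSections-section T A) ,
  (λ j → fromSections-conv T (τ j) (R j))
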